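{- The poset $(S_\infty,<_{\mathrm{Bruhat}})$ has no maximal element.
   Context: $S_\infty$ is the group of all bijections $\mathbb N\to\mathbb N$. Bruhat order: $\sigma\le_{\mathrm{Bruhat}}\omega$ iff for every $n$, the $i$-th smallest element of $\{\sigma(1),\dots,\sigma(n)\}$ is at most the $i$-th smallest element of $\{\omega(1),\dots,\omega(n)\}$ for all $i$. -}

module Defs where

open import Data.Nat using (ℕ; zero; suc; _≤_; _≤ᵇ_; _+_)
open import Data.Bool using (if_then_else_)
open import Data.List using (List; []; _∷_; map; upTo; length)
open import Function.Bundles using (_⤖_; Bijection)
open import Relation.Binary.PropositionalEquality using (_≡_)

-- S_∞ : bijections ℕ → ℕ (we index ℕ from 0; positions 1..n of the paper
-- correspond to 0..n-1 here, a harmless shift).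
S∞ : Set
S∞ = ℕ ⤖ ℕ

app : S∞ → ℕ → ℕ
app σ = Bijection.to σ

insert : ℕ → List ℕ → List ℕ
insert x [] = x ∷ []
insert x (y ∷ ys) = if x ≤ᵇ y then x ∷ y ∷ ys else y ∷ insert x ys

sort : List ℕ → List ℕ
sort [] = []
sort (x ∷ xs) = insert x (sort xs)

sortedPrefix : S∞ → ℕ → List ℕ
sortedPrefix σ n = sort (map (app σ) (upTo n))

data _≤ₗ_ : List ℕ → List ℕ → Set where
  []  : [] ≤ₗ []
  _∷_ : ∀ {x y xs ys} → x ≤ y → xs ≤ₗ ys → (x ∷ xs) ≤ₗ (y ∷ ys)

_≤B_ : S∞ → S∞ → Set
σ ≤B ω = ∀ n → sortedPrefix σ n ≤ₗ sortedPrefix ω n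

_≈P_ : S∞ → S∞ → Set
σ ≈P ω = ∀ n → app σ n ≡ app ω n

{-# OPTIONS --safe #-}
-- Every injective ω : ℕ → ℕ has an ascent ω i < ω (i + 1), since a strictly
-- decreasing run of naturals starting at ω 0 has length at most ω 0.
-- Composing ω with the transposition of i and i + 1 moves the larger value
-- ω (i + 1) into the prefix of length i + 1 and leaves every other prefix set
-- unchanged; inserting a larger element into the same sorted list gives a
-- pointwise larger list, so the new permutation lies strictly above ω.
module Submission where

open import Data.List using (List; []; _∷_; [_]; _∷ʳ_; map; upTo)
open import Data.List.Relation.Binary.Pointwise as Pointwise
  using (Pointwise; []; _∷_; Pointwise-≡⇒≡)
open import Data.List.Relation.Unary.Linked using ([]; [-]; _∷_; tail)
open import Relation.Binary using (DecTotalOrder; tri<; tri≈; tri>)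
open import Relation.Nullary using (¬_; yes; no; contradiction)

module InsertionSortProperties {a ℓ₁ ℓ₂} (O : DecTotalOrder a ℓ₁ ℓ₂) where

  open DecTotalOrder O using (_≤_; _≤?_; refl; trans; totalOrder; module Eq)
  open import Data.List.Sort.InsertionSort.Base O using (insert; sort)
  open import Data.List.Sort.InsertionSort.Properties O using (insert-congʳ; insert-swap)
  open import Data.List.Relation.Unary.Sorted.TotalOrder totalOrder using (Sorted)
  open import Data.List.Relation.Binary.Equality.Setoid Eq.setoid using (_≋_; ≋-refl; ≋-trans)
  open import Relation.Binary.Properties.DecTotalOrder O using (≰⇒≥)

  sort-∷ʳ : ∀ xs x → sort (xs ∷ʳ x) ≋ insert x (sort xs)
  sort-∷ʳ []       x = ≋-refl
  sort-∷ʳ (y ∷ xs) x = ≋-trans (insert-congʳ y (sort-∷ʳ xs x)) (insert-swap y x (sort xs))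

  ∷-≤-insert : ∀ {x y xs} → x ≤ y → Sorted (x ∷ xs) → Pointwise _≤_ (x ∷ xs) (insert y xs)
  ∷-≤-insert x≤y [-] = x≤y ∷ []
  ∷-≤-insert {y = y} x≤y (_∷_ {y = z} x≤z z∷zs↗) with y ≤? z
  ... | yes _   = x≤y ∷ Pointwise.refl refl
  ... | no y≰z  = x≤z ∷ ∷-≤-insert (≰⇒≥ y≰z) z∷zs↗

  insert-monoˡ : ∀ {x y xs} → x ≤ y → Sorted xs → Pointwise _≤_ (insert x xs) (insert y xs)
  insert-monoˡ x≤y [] = x≤y ∷ []
  insert-monoˡ {x} {y} {z ∷ _} x≤y z∷zs↗ with x ≤? z | y ≤? z
  ... | yes _   | yes _   = x≤y ∷ Pointwise.refl refl
  ... | yes x≤z | no y≰z  = x≤z ∷ ∷-≤-insert (≰⇒≥ y≰z) z∷zs↗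
  ... | no x≰z  | yes y≤z = contradiction (trans {x} {y} x≤y y≤z) x≰z
  ... | no _    | no _    = refl ∷ insert-monoˡ x≤y (tail z∷zs↗)

open import Defs using (S∞; app; sortedPrefix; _≤ₗ_; []; _∷_; _≤B_; _≈P_)
import Defs
open import Data.Bool using (if_then_else_)
open import Data.List.Properties using (map-++; upTo-∷ʳ)
open import Data.Nat using (ℕ; zero; suc; _≤_; _<_; _≤′_; ≤′-refl; ≤′-step; _≤ᵇ_; s≤s; z≤n)
open import Data.Nat.Properties
  using (≤-decTotalOrder; ≤-refl; <-≤-trans; ≤-pred; ≤⇒≤′; ≤′⇒≤; m<n⇒m<1+n;
         <-cmp; <⇒≢; <⇒≤; n≮0; 1+n≢n)
open import Data.Product using (Σ; _×_; _,_; ∃-syntax)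
open import Function using (_∘_)
open import Function.Bundles using (Bijection; _⤖_; mk↔ₛ′)
open import Function.Construct.Composition using (_⤖-∘_)
open import Function.Definitions using (Injective)
open import Function.Properties.Inverse using (↔⇒⤖)
open import Relation.Binary.PropositionalEquality
  using (_≡_; _≢_; refl; sym; trans; cong; cong₂; subst₂; module ≡-Reasoning)

open InsertionSortProperties ≤-decTotalOrder
open import Data.List.Sort.InsertionSort.Base ≤-decTotalOrder using (insert; sort)
open import Data.List.Sort.InsertionSort.Properties ≤-decTotalOrder using (insert-swap; sort-↗)

-- The library's insertion tests `does (x ≤? y)`, which for ℕ reduces to `x ≤ᵇ y`.
insert≡Defs-insert : ∀ x xs → Defs.insert x xs ≡ insert x xs
insert≡Defs-insert x []       = refl
insert≡Defs-insert x (y ∷ ys) =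
  cong (λ l → if x ≤ᵇ y then x ∷ y ∷ ys else y ∷ l) (insert≡Defs-insert x ys)

sort≡Defs-sort : ∀ xs → Defs.sort xs ≡ sort xs
sort≡Defs-sort []       = refl
sort≡Defs-sort (x ∷ xs) = begin
  Defs.insert x (Defs.sort xs) ≡⟨ insert≡Defs-insert x (Defs.sort xs) ⟩
  insert x (Defs.sort xs)      ≡⟨ cong (insert x) (sort≡Defs-sort xs) ⟩
  insert x (sort xs)           ∎
  where open ≡-Reasoning

prefixSort : (ℕ → ℕ) → ℕ → List ℕ
prefixSort f n = sort (map f (upTo n))

prefixSort-suc : ∀ f n → prefixSort f (suc n) ≡ insert (f n) (prefixSort f n)
prefixSort-suc f n = begin
  sort (map f (upTo (suc n)))   ≡⟨ cong (sort ∘ map f) (sym (upTo-∷ʳ n)) ⟩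
  sort (map f (upTo n ∷ʳ n))    ≡⟨ cong sort (map-++ f (upTo n) [ n ]) ⟩
  sort (map f (upTo n) ∷ʳ f n)  ≡⟨ Pointwise-≡⇒≡ (sort-∷ʳ (map f (upTo n)) (f n)) ⟩
  insert (f n) (prefixSort f n) ∎
  where open ≡-Reasoning

prefixSort-cong-≥ : ∀ {f g m n} → m ≤ n → prefixSort f m ≡ prefixSort g m →
                    (∀ k → m ≤ k → k < n → f k ≡ g k) → prefixSort f n ≡ prefixSort g n
prefixSort-cong-≥ {f} {g} {m} m≤n fₘ≡gₘ = go (≤⇒≤′ m≤n)
  where
  go : ∀ {n} → m ≤′ n → (∀ k → m ≤ k → k < n → f k ≡ g k) → prefixSort f n ≡ prefixSort g n
  go ≤′-refl _ = fₘ≡gₘ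
  go (≤′-step {n} m≤′n) f≗g = begin
    prefixSort f (suc n)          ≡⟨ prefixSort-suc f n ⟩
    insert (f n) (prefixSort f n) ≡⟨ cong₂ insert (f≗g n (≤′⇒≤ m≤′n) ≤-refl)
                                       (go m≤′n (λ k m≤k k<n → f≗g k m≤k (m<n⇒m<1+n k<n))) ⟩
    insert (g n) (prefixSort g n) ≡⟨ sym (prefixSort-suc g n) ⟩
    prefixSort g (suc n)          ∎
    where open ≡-Reasoning

prefixSort-cong-< : ∀ {f g n} → (∀ k → k < n → f k ≡ g k) → prefixSort f n ≡ prefixSort g n
prefixSort-cong-< f≗g = prefixSort-cong-≥ z≤n refl (λ k _ → f≗g k)

sortedPrefix≡prefixSort : ∀ σ n → sortedPrefix σ n ≡ prefixSort (app σ) n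
sortedPrefix≡prefixSort σ n = sort≡Defs-sort (map (app σ) (upTo n))

Pointwise⇒≤ₗ : ∀ {xs ys} → Pointwise _≤_ xs ys → xs ≤ₗ ys
Pointwise⇒≤ₗ []         = []
Pointwise⇒≤ₗ (x≤y ∷ ps) = x≤y ∷ Pointwise⇒≤ₗ ps

prefixSort-≤⇒≤B : ∀ {σ ω} →
                  (∀ n → Pointwise _≤_ (prefixSort (app σ) n) (prefixSort (app ω) n)) → σ ≤B ω
prefixSort-≤⇒≤B {σ} {ω} σ≤ω n =
  subst₂ _≤ₗ_ (sym (sortedPrefix≡prefixSort σ n)) (sym (sortedPrefix≡prefixSort ω n))
    (Pointwise⇒≤ₗ (σ≤ω n))

injective⇒ascent : ∀ {f : ℕ → ℕ} → Injective _≡_ _≡_ f → ∃[ i ] f i < f (suc i)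
injective⇒ascent {f} f-injective = ascent-within (f 0) 0 ≤-refl
  where
  ascent-within : ∀ k i → f i ≤ k → ∃[ j ] f j < f (suc j)
  ascent-within k i fᵢ≤k with <-cmp (f i) (f (suc i))
  ... | tri< fᵢ<fᵢ₊₁ _ _ = i , fᵢ<fᵢ₊₁
  ... | tri≈ _ fᵢ≡fᵢ₊₁ _ = contradiction (sym (f-injective fᵢ≡fᵢ₊₁)) 1+n≢n
  ascent-within zero    i fᵢ≤0 | tri> _ _ fᵢ₊₁<fᵢ = contradiction (<-≤-trans fᵢ₊₁<fᵢ fᵢ≤0) n≮0
  ascent-within (suc k) i fᵢ≤k | tri> _ _ fᵢ₊₁<fᵢ =
    ascent-within k (suc i) (≤-pred (<-≤-trans fᵢ₊₁<fᵢ fᵢ≤k))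

transposeSuc : ℕ → ℕ → ℕ
transposeSuc zero    zero          = 1
transposeSuc zero    (suc zero)    = 0
transposeSuc zero    (suc (suc k)) = suc (suc k)
transposeSuc (suc i) zero          = zero
transposeSuc (suc i) (suc k)       = suc (transposeSuc i k)

transposeSuc-involutive : ∀ i k → transposeSuc i (transposeSuc i k) ≡ k
transposeSuc-involutive zero    zero          = refl
transposeSuc-involutive zero    (suc zero)    = refl
transposeSuc-involutive zero    (suc (suc k)) = refl
transposeSuc-involutive (suc i) zero          = refl
transposeSuc-involutive (suc i) (suc k)       = cong suc (transposeSuc-involutive i k)

transposeSuc-i : ∀ i → transposeSuc i i ≡ suc i
transposeSuc-i zero    = refl
transposeSuc-i (suc i) = cong suc (transposeSuc-i i)

transposeSuc-suc-i : ∀ i → transposeSuc i (suc i) ≡ i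
transposeSuc-suc-i zero    = refl
transposeSuc-suc-i (suc i) = cong suc (transposeSuc-suc-i i)

transposeSuc-< : ∀ {i k} → k < i → transposeSuc i k ≡ k
transposeSuc-< {suc i} {zero}  _         = refl
transposeSuc-< {suc i} {suc k} (s≤s k<i) = cong suc (transposeSuc-< k<i)

transposeSuc-> : ∀ {i k} → suc i < k → transposeSuc i k ≡ k
transposeSuc-> {zero}  {suc zero}    (s≤s ())
transposeSuc-> {zero}  {suc (suc k)} _         = refl
transposeSuc-> {suc i} {suc k}       (s≤s i<k) = cong suc (transposeSuc-> i<k)

transposeSuc-⤖ : ℕ → ℕ ⤖ ℕ
transposeSuc-⤖ i = ↔⇒⤖ (mk↔ₛ′ (transposeSuc i) (transposeSuc i)
  (transposeSuc-involutive i) (transposeSuc-involutive i))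

swapAt : S∞ → ℕ → S∞
swapAt ω i = ω ⤖-∘ transposeSuc-⤖ i

module _ (ω : S∞) (i : ℕ) where

  private
    f g : ℕ → ℕ
    f = app ω
    g = app (swapAt ω i)

  swapAt-prefixSort-≤ : ∀ {n} → n ≤ i → prefixSort g n ≡ prefixSort f n
  swapAt-prefixSort-≤ n≤i =
    prefixSort-cong-< (λ k k<n → cong f (transposeSuc-< (<-≤-trans k<n n≤i)))

  swapAt-prefixSort-suc : prefixSort g (suc i) ≡ insert (f (suc i)) (prefixSort f i)
  swapAt-prefixSort-suc = begin
    prefixSort g (suc i)          ≡⟨ prefixSort-suc g i ⟩
    insert (g i) (prefixSort g i)       ≡⟨ cong₂ insert (cong f (transposeSuc-i i))
                                                          (swapAt-prefixSort-≤ ≤-refl) ⟩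
    insert (f (suc i)) (prefixSort f i) ∎
    where open ≡-Reasoning

  swapAt-prefixSort-≥ : ∀ {n} → suc (suc i) ≤ n → prefixSort g n ≡ prefixSort f n
  swapAt-prefixSort-≥ 2+i≤n =
    prefixSort-cong-≥ 2+i≤n prefixSort-2+i (λ k 2+i≤k _ → cong f (transposeSuc-> 2+i≤k))
    where
    open ≡-Reasoning
    prefixSort-2+i : prefixSort g (suc (suc i)) ≡ prefixSort f (suc (suc i))
    prefixSort-2+i = begin
      prefixSort g (suc (suc i))                         ≡⟨ prefixSort-suc g (suc i) ⟩
      insert (g (suc i)) (prefixSort g (suc i))          ≡⟨ cong₂ insert (cong f (transposeSuc-suc-i i))
                                                                         swapAt-prefixSort-suc ⟩
      insert (f i) (insert (f (suc i)) (prefixSort f i)) ≡⟨ Pointwise-≡⇒≡ (insert-swap _ _ (prefixSort f i)) ⟩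
      insert (f (suc i)) (insert (f i) (prefixSort f i)) ≡⟨ cong (insert (f (suc i))) (prefixSort-suc f i) ⟨
      insert (f (suc i)) (prefixSort f (suc i))          ≡⟨ prefixSort-suc f (suc i) ⟨
      prefixSort f (suc (suc i))                         ∎

  ≤B-swapAt : f i < f (suc i) → ω ≤B swapAt ω i
  ≤B-swapAt fᵢ<fᵢ₊₁ = prefixSort-≤⇒≤B {ω} {swapAt ω i} prefixSort-≤
    where
    ≡⇒≤ₚ : ∀ {xs ys} → xs ≡ ys → Pointwise _≤_ xs ys
    ≡⇒≤ₚ refl = Pointwise.refl {R = _≤_} ≤-refl

    prefixSort-≤ : ∀ n → Pointwise _≤_ (prefixSort f n) (prefixSort g n)
    prefixSort-≤ n with <-cmp n (suc i)
    ... | tri< n<1+i _ _ = ≡⇒≤ₚ (sym (swapAt-prefixSort-≤ (≤-pred n<1+i)))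
    ... | tri> _ _ 1+i<n = ≡⇒≤ₚ (sym (swapAt-prefixSort-≥ 1+i<n))
    ... | tri≈ _ refl _  = subst₂ (Pointwise _≤_) (sym (prefixSort-suc f i)) (sym swapAt-prefixSort-suc)
                             (insert-monoˡ (<⇒≤ fᵢ<fᵢ₊₁) (sort-↗ (map f (upTo i))))

  swapAt-≉P : f i ≢ f (suc i) → ¬ swapAt ω i ≈P ω
  swapAt-≉P fᵢ≢fᵢ₊₁ g≈f = fᵢ≢fᵢ₊₁ (sym (trans (cong f (sym (transposeSuc-i i))) (g≈f i)))

mainTheorem12 : (ω : S∞) → Σ S∞ (λ σ → (ω ≤B σ) × ¬ (σ ≈P ω))
mainTheorem12 ω with injective⇒ascent (Bijection.injective ω)
... | i , ωᵢ<ωᵢ₊₁ = swapAt ω i , ≤B-swapAt ω i ωᵢ<ωᵢ₊₁ , swapAt-≉P ω i (<⇒≢ ωᵢ<ωᵢ₊₁)
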